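{- Let $(S,+,0,\bullet,1)$ be a partial commutative semiring satisfying the standing assumptions below, $FX=\coprod_{\lambda\in\Lambda}X^{\mathrm{ar}(\lambda)}$, and $(C,\gamma)$ a $\mathsf{T}_S\circ F$-coalgebra. For every $c\in C$, the family $\mathcal M_c\subseteq\mathcal P(\mathsf{Paths}_c)$ is a Dynkin system on $\mathsf{Paths}_c$ (it contains $\mathsf{Paths}_c$, is closed under complements relative to $\mathsf{Paths}_c$, and is closed under countable unions of pairwise disjoint sets) and is moreover closed under (finite) intersections.
   Context: A partial commutative semiring is a tuple $(S,+,0,\bullet,1)$ where $+$ is a partial binary operation on $S$, commutative and associative whenever defined, with unit $0$; $(S,\bullet,1)$ is a commutative monoid; $s\bullet 0=0$; and whenever $t+u$ is defined, $s\bullet t+s\bullet u$ is defined and equals $s\bullet(t+u)$. Define $x\sqsubseteq y$ iff $x+z=y$ for some $z$. Standing assumptions: $\sqsubseteq$ is a partial order in which increasing $\omega$-chains have suprema and decreasing $\omega$-chains have infima, $1$ is the top element, $+$ and $\bullet$ preserve suprema of increasing and infima of decreasing $\omega$-chains in each argument; and $(S,\sqsubseteq)$ is a complete lattice. $\mathsf{T}_SX$ is the set of $\varphi:X\to S$ with finite support such that the sum of values is defined. $\Lambda$ is a set of symbols with arities $\mathrm{ar}(\lambda)\in\mathbb N$; elements of $FX$ are written $\iota_\lambda(x_1,\dots,x_{\mathrm{ar}(\lambda)})$; a $\mathsf{T}_S\circ F$-coalgebra is a map $\gamma:C\to\mathsf{T}_S(FC)$. A path is a possibly infinite ordered tree each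 node of which is labelled by $(d,\lambda)\in C\times\Lambda$ and has exactly $\mathrm{ar}(\lambda)$ children. A path from $c$ in $(C,\gamma)$ has root labelled $(c,\lambda)$ for some $\lambda$ and at every node labelled $(d,\lambda)$ whose children have root states $d_1,\dots,d_n$ satisfies $\gamma(d)(\iota_\lambda(d_1,\dots,d_n))\neq0$; $\mathsf{Paths}_c$ is the set of these. If $\gamma(c)(\iota_\lambda(c_1,\dots,c_n))\neq0$ and $P_i\subseteq\mathsf{Paths}_{c_i}$, let $(c,\lambda)(c_1,\dots,c_n)[P_1,\dots,P_n]$ be the set of paths with root $(c,\lambda)$ whose $i$-th child subtree lies in $P_i$. The families $\mathcal M_c$ ($c\in C$) are the least families of subsets of $\mathsf{Paths}_c$ such that: $\mathsf{Paths}_c\in\mathcal M_c$; $(c,\lambda)(c_1,\dots,c_n)[P_1,\dots,P_n]\in\mathcal M_c$ whenever $\gamma(c)(\iota_\lambda(c_1,\dots,c_n))\neq0$ and $P_i\in\mathcal M_{c_i}$; $\mathcal M_c$ is closed under finite unions of pairwise disjoint sets (in particular $\emptyset\in\mathcal M_c$), under unions of increasing $\omega$-chains, and under intersections of decreasing $\omega$-chains. -}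

module Defs where

open import Level using (0ℓ)
open import Data.Nat using (ℕ; suc)
open import Data.Fin using (Fin)
open import Data.Vec using (Vec; lookup; tabulate)
open import Data.Maybe using (Maybe; just; nothing; _>>=_)
open import Data.List using (List; []; _∷_; map)
open import Data.List.Membership.Propositional using (_∈_)
open import Data.List.Relation.Unary.Unique.Propositional using (Unique)
open import Data.Product using (Σ; Σ-syntax; ∃; _×_; _,_; proj₁)
open import Data.Sum using (_⊎_)
open import Data.Unit using (⊤)
open import Data.Empty using (⊥)
open import Relation.Nullary using (¬_)
open import Relation.Binary.PropositionalEquality using (_≡_; _≢_; subst; cong; sym)
open import Relation.Binary.Structures using (IsPartialOrder)
open import Function.Bundles using (_⇔_)

-- Partial commutative semirings.
-- The partial addition is a function into Maybe S (nothing = undefined).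

record PCSemiring : Set₁ where
  infixl 6 _⊕_
  infixl 7 _•_
  field
    S     : Set
    _⊕_   : S → S → Maybe S
    𝟘     : S
    _•_   : S → S → S
    𝟙     : S
    ⊕-comm      : ∀ x y → x ⊕ y ≡ y ⊕ x
    -- associativity whenever defined (Kleene equality of (x+y)+z and x+(y+z))
    ⊕-assoc     : ∀ x y z → ((x ⊕ y) >>= λ a → a ⊕ z) ≡ ((y ⊕ z) >>= λ b → x ⊕ b)
    ⊕-identityʳ : ∀ x → x ⊕ 𝟘 ≡ just x
    •-comm      : ∀ x y → x • y ≡ y • x
    •-assoc     : ∀ x y z → (x • y) • z ≡ x • (y • z)
    •-identityʳ : ∀ x → x • 𝟙 ≡ x
    •-zeroʳ     : ∀ s → s • 𝟘 ≡ 𝟘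
    distrib     : ∀ s t u v → t ⊕ u ≡ just v → (s • t) ⊕ (s • u) ≡ just (s • v)

  _⊑_ : S → S → Set
  x ⊑ y = ∃ λ z → x ⊕ z ≡ just y

  Increasing : (ℕ → S) → Set
  Increasing x = ∀ n → x n ⊑ x (suc n)

  Decreasing : (ℕ → S) → Set
  Decreasing x = ∀ n → x (suc n) ⊑ x n

  IsSup : (ℕ → S) → S → Set
  IsSup x s = (∀ n → x n ⊑ s) × (∀ u → (∀ n → x n ⊑ u) → s ⊑ u)

  IsInf : (ℕ → S) → S → Set
  IsInf x s = (∀ n → s ⊑ x n) × (∀ u → (∀ n → u ⊑ x n) → u ⊑ s)

  IsLUB : (S → Set) → S → Set
  IsLUB A s = (∀ a → A a → a ⊑ s) × (∀ u → (∀ a → A a → a ⊑ u) → s ⊑ u)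

  IsGLB : (S → Set) → S → Set
  IsGLB A s = (∀ a → A a → s ⊑ a) × (∀ u → (∀ a → A a → u ⊑ a) → u ⊑ s)

record StandingAssumptions (R : PCSemiring) : Set₁ where
  open PCSemiring R
  field
    ⊑-isPartialOrder : IsPartialOrder _≡_ _⊑_
    sup-exists : ∀ x → Increasing x → ∃ (IsSup x)
    inf-exists : ∀ x → Decreasing x → ∃ (IsInf x)
    𝟙-top      : ∀ x → x ⊑ 𝟙
    ⊕-sup-left  : ∀ x s y z → Increasing x → IsSup x s →
                  (∀ n → x n ⊕ y ≡ just (z n)) → Σ[ t ∈ S ] (s ⊕ y ≡ just t × IsSup z t)
    ⊕-sup-right : ∀ y x s z → Increasing x → IsSup x s →
                  (∀ n → y ⊕ x n ≡ just (z n)) → Σ[ t ∈ S ] (y ⊕ s ≡ just t × IsSup z t)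
    ⊕-inf-left  : ∀ x s y z → Decreasing x → IsInf x s →
                  (∀ n → x n ⊕ y ≡ just (z n)) → Σ[ t ∈ S ] (s ⊕ y ≡ just t × IsInf z t)
    ⊕-inf-right : ∀ y x s z → Decreasing x → IsInf x s →
                  (∀ n → y ⊕ x n ≡ just (z n)) → Σ[ t ∈ S ] (y ⊕ s ≡ just t × IsInf z t)
    •-sup-left  : ∀ x s y → Increasing x → IsSup x s → IsSup (λ n → x n • y) (s • y)
    •-sup-right : ∀ y x s → Increasing x → IsSup x s → IsSup (λ n → y • x n) (y • s)
    •-inf-left  : ∀ x s y → Decreasing x → IsInf x s → IsInf (λ n → x n • y) (s • y)
    •-inf-right : ∀ y x s → Decreasing x → IsInf x s → IsInf (λ n → y • x n) (y • s)
    lub-exists : ∀ (A : S → Set) → ∃ (IsLUB A)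
    glb-exists : ∀ (A : S → Set) → ∃ (IsGLB A)

-- The functor T_S : finitely supported S-valued maps whose sum is defined.

module _ (R : PCSemiring) where
  open PCSemiring R

  psum : List S → Maybe S
  psum []       = just 𝟘
  psum (x ∷ xs) = psum xs >>= λ s → x ⊕ s

  record T (X : Set) : Set where
    field
      φ        : X → S
      support  : List X
      unique   : Unique support
      covers   : ∀ x → φ x ≢ 𝟘 → x ∈ support
      sum-def  : psum (map φ support) ≢ nothing

F : (Λ : Set) (ar : Λ → ℕ) → Set → Set
F Λ ar X = Σ[ l ∈ Λ ] Vec X (ar l)

module Paths (R : PCSemiring) (Λ : Set) (ar : Λ → ℕ) (C : Set)
             (γ : C → T R (F Λ ar C)) where
  open PCSemiring R

  w : C → F Λ ar C → S
  w c = T.φ (γ c)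

  record Tree : Set where
    coinductive
    field
      state    : C
      label    : Λ
      children : Fin (ar label) → Tree
  open Tree public

  childStates : Tree → F Λ ar C
  childStates t = label t , tabulate (λ i → state (children t i))

  record IsPath (t : Tree) : Set where
    coinductive
    field
      step : w (state t) (childStates t) ≢ 𝟘
      sub  : ∀ i → IsPath (children t i)
  open IsPath public

  Path : C → Set
  Path c = Σ[ t ∈ Tree ] (IsPath t × state t ≡ c)

  Subset : C → Set₁
  Subset c = Path c → Set

  -- (c,λ)(c₁,…,cₙ)[P₁,…,Pₙ] : root labelled (c,λ), i-th child subtree has root
  -- state cᵢ and lies in Pᵢ
  Cyl : (c : C) (l : Λ) (cs : Vec C (ar l)) →
        ((i : Fin (ar l)) → Subset (lookup cs i)) → Subset c
  Cyl c l cs Ps (t , ip , _) =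
    Σ[ e ∈ label t ≡ l ] ∀ (i : Fin (ar l)) →
      let j = subst Fin (cong ar (sym e)) i in
      Σ[ e′ ∈ state (children t j) ≡ lookup cs i ]
        Ps i (children t j , sub ip j , e′)

  _∪_ : ∀ {c} → Subset c → Subset c → Subset c
  (P ∪ Q) p = P p ⊎ Q p

  _∩_ : ∀ {c} → Subset c → Subset c → Subset c
  (P ∩ Q) p = P p × Q p

  ∁ : ∀ {c} → Subset c → Subset c
  ∁ P p = ¬ P p

  ⋃ : ∀ {c} → (ℕ → Subset c) → Subset c
  ⋃ A p = ∃ λ n → A n p

  ⋂ : ∀ {c} → (ℕ → Subset c) → Subset c
  ⋂ A p = ∀ n → A n p

  _⊆_ : ∀ {c} → Subset c → Subset c → Set
  P ⊆ Q = ∀ p → P p → Q p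

  Disjoint : ∀ {c} → Subset c → Subset c → Set
  Disjoint P Q = ∀ p → P p → Q p → ⊥

  -- the least families M_c; sets are extensional, so membership is closed
  -- under (pointwise) equality of subsets (constructor `ext`)
  data M : (c : C) → Subset c → Set₁ where
    full      : ∀ {c} → M c (λ _ → ⊤)
    cyl       : ∀ {c} (l : Λ) (cs : Vec C (ar l)) → w c (l , cs) ≢ 𝟘 →
                (Ps : (i : Fin (ar l)) → Subset (lookup cs i)) →
                (∀ i → M (lookup cs i) (Ps i)) → M c (Cyl c l cs Ps)
    empty     : ∀ {c} → M c (λ _ → ⊥)
    disjUnion : ∀ {c} {P Q : Subset c} → Disjoint P Q → M c P → M c Q → M c (P ∪ Q)
    chainUnion : ∀ {c} (A : ℕ → Subset c) → (∀ n → A n ⊆ A (suc n)) →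
                 (∀ n → M c (A n)) → M c (⋃ A)
    chainInter : ∀ {c} (A : ℕ → Subset c) → (∀ n → A (suc n) ⊆ A n) →
                 (∀ n → M c (A n)) → M c (⋂ A)
    ext       : ∀ {c} {P Q : Subset c} → M c P → (∀ p → P p ⇔ Q p) → M c Q

  IsDynkin : (c : C) → (Subset c → Set₁) → Set₁
  IsDynkin c 𝓜 =
    𝓜 (λ _ → ⊤) ×
    (∀ P → 𝓜 P → 𝓜 (∁ P)) ×
    (∀ (A : ℕ → Subset c) → (∀ m n → m ≢ n → Disjoint (A m) (A n)) →
       (∀ n → 𝓜 (A n)) → 𝓜 (⋃ A))

  ClosedUnderIntersection : (c : C) → (Subset c → Set₁) → Set₁
  ClosedUnderIntersection c 𝓜 = ∀ P Q → 𝓜 P → 𝓜 Q → 𝓜 (P ∩ Q)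

module Submission where

-- The only interesting constructor is the cylinder
-- (c,λ)(c₁,…,cₙ)[P₁,…,Pₙ]; all other constructors commute with ∩ and ∁
-- by elementary set algebra.
-- Complements and the case distinctions in them are classical, so the proof
-- uses the excluded middle that the statement provides.

open import Defs
open import Level using (0ℓ)
open import Data.Nat using (ℕ; zero; suc; _≤_; z≤n)
open import Data.Nat.Properties using (≤-refl; m≤n⇒m≤1+n; 1+n≰n)
open import Data.Fin using (Fin) renaming (zero to fzero; suc to fsuc)
open import Data.Fin.Properties using () renaming (_≟_ to _≟ᶠ_)
open import Data.Vec using (Vec; lookup)
open import Data.Vec.Properties using (tabulate-cong; tabulate∘lookup; lookup∘tabulate)
open import Data.List using (List; []; _∷_)
open import Data.List.Membership.Propositional using (_∈_)
open import Data.List.Relation.Unary.Any as Any using (Any; here; there)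
open import Data.List.Relation.Unary.All as All using (All; []; _∷_)
open import Data.List.Relation.Unary.AllPairs as AllPairs using (AllPairs; []; _∷_)
open import Data.Product using (∃; _×_; _,_; proj₁; proj₂)
open import Data.Sum using (inj₁; inj₂)
open import Data.Unit using (⊤; tt)
open import Data.Empty using (⊥; ⊥-elim)
open import Relation.Nullary using (¬_; yes; no)
open import Relation.Binary.PropositionalEquality using (_≡_; _≢_; refl; subst; cong; sym; trans)
open import Function.Bundles using (_⇔_; mk⇔; Equivalence)
open import Axiom.UniquenessOfIdentityProofs.WithK using (uip)
open import Axiom.ExcludedMiddle using (ExcludedMiddle)
open import Axiom.DoubleNegationElimination using (em⇒dne)

module Proof (R : PCSemiring) (Λ : Set) (ar : Λ → ℕ) (C : Set)
             (γ : C → T R (F Λ ar C)) (em : ExcludedMiddle 0ℓ) where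
  open PCSemiring R using (𝟘)
  open Paths R Λ ar C γ
  open Equivalence using (to; from)

  Ω ∅ : ∀ {c} → Subset c
  Ω _ = ⊤
  ∅ _ = ⊥

  reshape : ∀ {c} {P Q : Subset c} → M c P → P ⊆ Q → Q ⊆ P → M c Q
  reshape m P⊆Q Q⊆P = ext m (λ p → mk⇔ (P⊆Q p) (Q⊆P p))

  root : ∀ {c} → Path c → F Λ ar C
  root (t , _) = childStates t

  root-weight : ∀ {c} (p : Path c) → w c (root p) ≢ 𝟘
  root-weight (t , ip , refl) = step ip

  root∈support : ∀ {c} (p : Path c) → root p ∈ T.support (γ c)
  root∈support {c} p = T.covers (γ c) (root p) (root-weight p)

  Basic : (c : C) → F Λ ar C → Subset c
  Basic c (l , cs) = Cyl c l cs (λ _ _ → ⊤)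

  cyl⊆basic : ∀ {c l cs} (Ps : ∀ i → Subset (lookup cs i)) → Cyl c l cs Ps ⊆ Basic c (l , cs)
  cyl⊆basic Ps _ (e , f) = e , λ i → proj₁ (f i) , tt

  cyl-root : ∀ {c l cs} (Ps : ∀ i → Subset (lookup cs i)) (p : Path c) →
             Cyl c l cs Ps p → root p ≡ (l , cs)
  cyl-root Ps (t , _) (refl , f) =
    cong (label t ,_) (trans (tabulate-cong (λ i → proj₁ (f i))) (tabulate∘lookup _))

  basic-disjoint : ∀ {c x y} → x ≢ y → Disjoint (Basic c x) (Basic c y)
  basic-disjoint {x = _ , _} {y = _ , _} x≢y p κ κ′ =
    x≢y (trans (sym (cyl-root _ p κ)) (cyl-root _ p κ′))

  root-basic : ∀ {c} (p : Path c) → Basic c (root p) p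
  root-basic (t , _) = refl , λ i → sym (lookup∘tabulate (λ j → state (children t j)) i) , tt

  child : ∀ {c l cs} (p : Path c) → Basic c (l , cs) p → (i : Fin (ar l)) → Path (lookup cs i)
  child (t , ip , _) (refl , f) i = children t i , sub ip i , proj₁ (f i)

  cyl⇔children : ∀ {c l cs} (p : Path c) (κ : Basic c (l , cs) p)
                 (Ps : ∀ i → Subset (lookup cs i)) →
                 Cyl c l cs Ps p ⇔ (∀ i → Ps i (child {cs = cs} p κ i))
  cyl⇔children (t , ip , _) (refl , f) Ps = mk⇔
    (λ { (refl , g) i → subst (λ e → Ps i (children t i , sub ip i , e))
                              (uip (proj₁ (g i)) (proj₁ (f i))) (proj₂ (g i)) })
    (λ h → refl , λ i → proj₁ (f i) , h i)

  cyl∩cyl : ∀ {c l cs} (Ps Qs : ∀ i → Subset (lookup cs i)) (p : Path c) →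
            (Cyl c l cs Ps ∩ Cyl c l cs Qs) p ⇔ Cyl c l cs (λ i → Ps i ∩ Qs i) p
  cyl∩cyl {c} {l} {cs} Ps Qs p = mk⇔
    (λ (x , y) → let κ = cyl⊆basic {cs = cs} Ps p x in
      from (by-children κ Ps∩Qs) (λ i → to (by-children κ Ps) x i , to (by-children κ Qs) y i))
    (λ z → let κ = cyl⊆basic {cs = cs} Ps∩Qs p z ; ch = to (by-children κ Ps∩Qs) z in
      from (by-children κ Ps) (λ i → proj₁ (ch i)) , from (by-children κ Qs) (λ i → proj₂ (ch i)))
    where
      by-children : (κ : Basic c (l , cs) p) (Xs : ∀ i → Subset (lookup cs i)) →
                    Cyl c l cs Xs p ⇔ (∀ i → Xs i (child {cs = cs} p κ i))
      by-children = cyl⇔children {cs = cs} p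

      Ps∩Qs : ∀ i → Subset (lookup cs i)
      Ps∩Qs i = Ps i ∩ Qs i

  -- Intersection is commutative, so the lemmas below serve both arguments.
  ∩-comm : ∀ {c} {P Q : Subset c} → M c (P ∩ Q) → M c (Q ∩ P)
  ∩-comm m = reshape m (λ _ (a , b) → b , a) (λ _ (b , a) → a , b)

  -- For a fixed P, the family of Q with P ∩ Q ∈ M is closed under every
  -- constructor of M other than the cylinder (full needs P ∈ M itself).
  module Meets {c} {P : Subset c} where
    meets-full : M c P → M c (P ∩ Ω)
    meets-full m = reshape m (λ _ a → a , tt) (λ _ → proj₁)

    meets-empty : M c (P ∩ ∅)
    meets-empty = reshape empty (λ _ ()) (λ _ → proj₂)

    meets-∪ : ∀ {A B} → Disjoint A B → M c (P ∩ A) → M c (P ∩ B) → M c (P ∩ (A ∪ B))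
    meets-∪ A#B mA mB = reshape (disjUnion (λ p (_ , a) (_ , b) → A#B p a b) mA mB)
      (λ { _ (inj₁ (x , a)) → x , inj₁ a ; _ (inj₂ (x , b)) → x , inj₂ b })
      (λ { _ (x , inj₁ a) → inj₁ (x , a) ; _ (x , inj₂ b) → inj₂ (x , b) })

    meets-⋃ : ∀ A → (∀ n → A n ⊆ A (suc n)) → (∀ n → M c (P ∩ A n)) → M c (P ∩ ⋃ A)
    meets-⋃ A inc mA = reshape (chainUnion (λ n → P ∩ A n) (λ n p (x , a) → x , inc n p a) mA)
      (λ _ (n , x , a) → x , n , a) (λ _ (x , n , a) → n , x , a)

    meets-⋂ : ∀ A → (∀ n → A (suc n) ⊆ A n) → (∀ n → M c (P ∩ A n)) → M c (P ∩ ⋂ A)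
    meets-⋂ A dec mA = reshape (chainInter (λ n → P ∩ A n) (λ n p (x , a) → x , dec n p a) mA)
      (λ _ f → proj₁ (f 0) , λ n → proj₂ (f n)) (λ _ (x , g) n → x , g n)

    meets-ext : ∀ {A B} → (∀ p → A p ⇔ B p) → M c (P ∩ A) → M c (P ∩ B)
    meets-ext A⇔B m = reshape m (λ p (x , a) → x , to (A⇔B p) a) (λ p (x , b) → x , from (A⇔B p) b)
  open Meets

  -- Two cylinders with the same root transition meet
  -- in the cylinder of the childwise intersections, otherwise in ∅.
  module CylinderMeets {c l} {cs : Vec C (ar l)} (nz : w c (l , cs) ≢ 𝟘)
           (Ps : ∀ i → Subset (lookup cs i)) (mPs : ∀ i → M (lookup cs i) (Ps i))
           (childMeets : ∀ i {Q} → M (lookup cs i) Q → M (lookup cs i) (Ps i ∩ Q)) where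
    cyl-meets : ∀ {Q} → M c Q → M c (Cyl c l cs Ps ∩ Q)
    cyl-meets full = meets-full (cyl l cs nz Ps mPs)
    cyl-meets empty = meets-empty
    cyl-meets (disjUnion A#B mA mB) = meets-∪ A#B (cyl-meets mA) (cyl-meets mB)
    cyl-meets (chainUnion A inc mA) = meets-⋃ A inc (λ n → cyl-meets (mA n))
    cyl-meets (chainInter A dec mA) = meets-⋂ A dec (λ n → cyl-meets (mA n))
    cyl-meets (ext m A⇔B) = meets-ext A⇔B (cyl-meets m)
    cyl-meets (cyl l′ cs′ _ Qs mQs) with em {P = _≡_ {A = F Λ ar C} (l , cs) (l′ , cs′)}
    ... | yes refl = reshape (cyl l cs nz (λ i → Ps i ∩ Qs i) (λ i → childMeets i (mQs i)))
                             (λ p → from (cyl∩cyl {cs = cs} Ps Qs p))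
                             (λ p → to (cyl∩cyl {cs = cs} Ps Qs p))
    ... | no different = reshape empty (λ _ ())
          (λ p (x , y) → different (trans (sym (cyl-root {cs = cs} Ps p x)) (cyl-root {cs = cs′} Qs p y)))
  open CylinderMeets using (cyl-meets)

  ∩-closed : ∀ {c} {P Q : Subset c} → M c P → M c Q → M c (P ∩ Q)
  ∩-closed (cyl l cs nz Ps mPs) mQ = cyl-meets nz Ps mPs (λ i → ∩-closed (mPs i)) mQ
  ∩-closed full mQ = ∩-comm (meets-full mQ)
  ∩-closed empty _ = ∩-comm meets-empty
  ∩-closed (disjUnion A#B mA mB) mQ =
    ∩-comm (meets-∪ A#B (∩-comm (∩-closed mA mQ)) (∩-comm (∩-closed mB mQ)))
  ∩-closed (chainUnion A inc mA) mQ = ∩-comm (meets-⋃ A inc (λ n → ∩-comm (∩-closed (mA n) mQ)))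
  ∩-closed (chainInter A dec mA) mQ = ∩-comm (meets-⋂ A dec (λ n → ∩-comm (∩-closed (mA n) mQ)))
  ∩-closed (ext m A⇔B) mQ = ∩-comm (meets-ext A⇔B (∩-comm (∩-closed m mQ)))

  ⋃-list : ∀ {c} {X : Set} (A : X → Subset c) (xs : List X) →
           AllPairs (λ x y → Disjoint (A x) (A y)) xs → All (λ x → M c (A x)) xs →
           M c (λ p → Any (λ x → A x p) xs)
  ⋃-list A [] [] [] = reshape empty (λ _ ()) (λ _ ())
  ⋃-list A (x ∷ xs) (x#xs ∷ xs#) (mx ∷ mxs) =
    reshape (disjUnion apart mx (⋃-list A xs xs# mxs))
      (λ { _ (inj₁ a) → here a ; _ (inj₂ as) → there as })
      (λ { _ (here a) → inj₁ a ; _ (there as) → inj₂ as })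
    where
      apart : Disjoint (A x) (λ p → Any (λ y → A y p) xs)
      apart p a as = All.lookupWith {R = λ _ → ⊥} (λ x#y b → x#y p a b) x#xs as

  -- Basic cylinders belong to M (a transition of weight 0 has an empty one).
  basic∈M : ∀ {c} x → M c (Basic c x)
  basic∈M {c} (l , cs) with em {P = w c (l , cs) ≡ 𝟘}
  ... | no nz = cyl l cs nz (λ _ → Ω) (λ _ → full)
  ... | yes z = reshape empty (λ _ ())
                  (λ p κ → root-weight p (trans (cong (w c) (cyl-root {cs = cs} _ p κ)) z))

  -- The complement of the basic cylinder of y is the disjoint union of the
  -- basic cylinders of the other transitions in the (finite) support of γ(c).
  ∁basic∈M : ∀ {c} y → M c (∁ (Basic c y))
  ∁basic∈M {c} y =
    reshape (⋃-list Other (T.support (γ c)) others-disjoint (All.universal other∈M _))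
      (λ p any κ → let (x , x≢y , κx) = Any.satisfied any in basic-disjoint x≢y p κx κ)
      (λ p ¬κ → Any.map (λ root≡x → (λ x≡y → ¬κ (basic-of {p} (trans root≡x x≡y))) ,
                                    basic-of {p} root≡x)
                        (root∈support p))
    where
      Other : F Λ ar C → Subset c
      Other x p = x ≢ y × Basic c x p

      other∈M : ∀ x → M c (Other x)
      other∈M x with em {P = x ≡ y}
      ... | yes x≡y = reshape empty (λ _ ()) (λ _ (x≢y , _) → x≢y x≡y)
      ... | no x≢y = reshape (basic∈M x) (λ _ κ → x≢y , κ) (λ _ → proj₂)

      others-disjoint : AllPairs (λ x x′ → Disjoint (Other x) (Other x′)) (T.support (γ c))
      others-disjoint = AllPairs.map (λ x≢x′ p (_ , κ) (_ , κ′) → basic-disjoint x≢x′ p κ κ′)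
                                     (T.unique (γ c))

      basic-of : ∀ {p x} → root p ≡ x → Basic c x p
      basic-of {p} root≡x = subst (λ x → Basic c x p) root≡x (root-basic p)

  -- If X ⊆ A, then ∁X is the disjoint union of ∁A and A ∖ X.
  ∁-by-cases : ∀ {c} {A X : Subset c} → X ⊆ A → M c (∁ A) → M c (A ∩ ∁ X) → M c (∁ X)
  ∁-by-cases {A = A} {X = X} X⊆A m∁A mA∖X =
    reshape (disjUnion (λ _ ¬a (a , _) → ¬a a) m∁A mA∖X)
      (λ { p (inj₁ ¬a) x → ¬a (X⊆A p x) ; _ (inj₂ (_ , ¬x)) → ¬x })
      split
    where
      split : ∀ p → ∁ X p → (∁ A ∪ (A ∩ ∁ X)) p
      split p ¬x with em {P = A p}
      ... | yes a = inj₂ (a , ¬x)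
      ... | no ¬a = inj₁ ¬a

  -- ∁(A ∩ B) = ∁A ⊎ (A ∖ B).
  ∁-∩ : ∀ {c} {A B : Subset c} → M c A → M c (∁ A) → M c (∁ B) → M c (∁ (A ∩ B))
  ∁-∩ mA m∁A m∁B = ∁-by-cases (λ _ → proj₁) m∁A
    (reshape (∩-closed mA m∁B) (λ _ (a , ¬b) → a , λ (_ , b) → ¬b b)
                               (λ _ (a , ¬ab) → a , λ b → ¬ab (a , b)))

  ⋂ᶠ : ∀ {c n} → (Fin n → Subset c) → Subset c
  ⋂ᶠ A p = ∀ i → A i p

  ∁-⋂ᶠ : ∀ {c} n (A : Fin n → Subset c) → (∀ i → M c (A i)) → (∀ i → M c (∁ (A i))) →
         M c (∁ (⋂ᶠ A))
  ∁-⋂ᶠ zero A _ _ = reshape empty (λ _ ()) (λ _ ¬all → ¬all (λ ()))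
  ∁-⋂ᶠ (suc n) A mA m∁A =
    reshape (∁-∩ (mA fzero) (m∁A fzero)
                 (∁-⋂ᶠ n (λ i → A (fsuc i)) (λ i → mA (fsuc i)) (λ i → m∁A (fsuc i))))
      (λ _ ¬both all → ¬both (all fzero , λ i → all (fsuc i)))
      (λ _ ¬all (a , as) → ¬all λ { fzero → a ; (fsuc i) → as i })

  Only : ∀ {l} (cs : Vec C (ar l)) (i : Fin (ar l)) → Subset (lookup cs i) →
         ∀ j → Subset (lookup cs j)
  Only cs i Q j with j ≟ᶠ i
  ... | yes refl = Q
  ... | no _ = Ω

  only-elim : ∀ {l} {cs : Vec C (ar l)} {i Q x} → Only cs i Q i x → Q x
  only-elim {i = i} q with i ≟ᶠ i
  ... | yes refl = q
  ... | no i≢i = ⊥-elim (i≢i refl)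

  only-intro : ∀ {l} {cs : Vec C (ar l)} {i Q} (x : ∀ j → Path (lookup cs j)) → Q (x i) →
               ∀ j → Only cs i Q j (x j)
  only-intro {i = i} x q j with j ≟ᶠ i
  ... | yes refl = q
  ... | no _ = tt

  only∈M : ∀ {l} (cs : Vec C (ar l)) i {Q} → M (lookup cs i) Q → ∀ j → M (lookup cs j) (Only cs i Q j)
  only∈M cs i mQ j with j ≟ᶠ i
  ... | yes refl = mQ
  ... | no _ = full

  cyl-only⇔ : ∀ {c l cs} (p : Path c) (κ : Basic c (l , cs) p) i (Q : Subset (lookup cs i)) →
              Cyl c l cs (Only cs i Q) p ⇔ Q (child {cs = cs} p κ i)
  cyl-only⇔ {cs = cs} p κ i Q = mk⇔
    (λ x → only-elim {cs = cs} {i = i} {Q = Q} (to (cyl⇔children {cs = cs} p κ (Only cs i Q)) x i))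
    (λ q → from (cyl⇔children {cs = cs} p κ (Only cs i Q)) (only-intro (child {cs = cs} p κ) q))

  -- Complement of a one-coordinate cylinder: outside the basic cylinder, or
  -- inside it with i-th child in ∁Q.
  ∁only∈M : ∀ {c l cs} → w c (l , cs) ≢ 𝟘 → ∀ i {Q : Subset (lookup cs i)} →
            M (lookup cs i) (∁ Q) → M c (∁ (Cyl c l cs (Only cs i Q)))
  ∁only∈M {c} {l} {cs} nz i {Q} m∁Q =
    ∁-by-cases (cyl⊆basic {cs = cs} (Only cs i Q)) (∁basic∈M (l , cs))
      (reshape (cyl l cs nz (Only cs i (∁ Q)) (only∈M cs i m∁Q))
        (λ p x → let κ = cyl⊆basic {cs = cs} (Only cs i (∁ Q)) p x in
                 κ , λ y → to (cyl-only⇔ {cs = cs} p κ i (∁ Q)) x (to (cyl-only⇔ {cs = cs} p κ i Q) y))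
        (λ p (κ , ¬y) → from (cyl-only⇔ {cs = cs} p κ i (∁ Q))
                             (λ q → ¬y (from (cyl-only⇔ {cs = cs} p κ i Q) q))))

  -- Complement of a cylinder whose children sets and their complements are
  -- in M: inside the basic cylinder, the cylinder is the finite intersection
  -- of its one-coordinate cylinders.
  ∁cyl∈M : ∀ {c l cs} → w c (l , cs) ≢ 𝟘 → (Ps : ∀ i → Subset (lookup cs i)) →
           (∀ i → M (lookup cs i) (Ps i)) → (∀ i → M (lookup cs i) (∁ (Ps i))) →
           M c (∁ (Cyl c l cs Ps))
  ∁cyl∈M {c} {l} {cs} nz Ps mPs m∁Ps =
    ∁-by-cases (cyl⊆basic {cs = cs} Ps) (∁basic∈M (l , cs))
      (reshape (∩-closed (basic∈M (l , cs))
                         (∁-⋂ᶠ (ar l) A (λ i → cyl l cs nz _ (only∈M cs i (mPs i)))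
                                        (λ i → ∁only∈M nz i (m∁Ps i))))
        (λ p (κ , ¬all) → κ , λ x → ¬all (to (cyl⇔⋂ p κ) x))
        (λ p (κ , ¬x) → κ , λ all → ¬x (from (cyl⇔⋂ p κ) all)))
    where
      A : Fin (ar l) → Subset c
      A i = Cyl c l cs (Only cs i (Ps i))

      cyl⇔⋂ : ∀ p (κ : Basic c (l , cs) p) → Cyl c l cs Ps p ⇔ ⋂ᶠ A p
      cyl⇔⋂ p κ = mk⇔
        (λ x i → from (cyl-only⇔ {cs = cs} p κ i (Ps i)) (to (cyl⇔children {cs = cs} p κ Ps) x i))
        (λ all → from (cyl⇔children {cs = cs} p κ Ps)
                      (λ i → to (cyl-only⇔ {cs = cs} p κ i (Ps i)) (all i)))

  dne : ∀ {P : Set} → ¬ ¬ P → P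
  dne = em⇒dne em

  -- Unions and intersections swap by De
  -- Morgan (classically for ∁ of an intersection); cylinders are handled by
  -- ∁cyl∈M, using the complements of the children sets.
  ∁-closed : ∀ {c} {P : Subset c} → M c P → M c (∁ P)
  ∁-closed full = reshape empty (λ _ ()) (λ _ ¬⊤ → ¬⊤ tt)
  ∁-closed empty = reshape full (λ _ _ ()) (λ _ _ → tt)
  ∁-closed (cyl l cs nz Ps mPs) = ∁cyl∈M nz Ps mPs (λ i → ∁-closed (mPs i))
  ∁-closed (disjUnion _ mA mB) = reshape (∩-closed (∁-closed mA) (∁-closed mB))
    (λ { _ (¬a , _) (inj₁ a) → ¬a a ; _ (_ , ¬b) (inj₂ b) → ¬b b })
    (λ _ ¬a∪b → (λ a → ¬a∪b (inj₁ a)) , (λ b → ¬a∪b (inj₂ b)))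
  ∁-closed (chainUnion A inc mA) =
    reshape (chainInter (λ n → ∁ (A n)) (λ n p ¬a a → ¬a (inc n p a)) (λ n → ∁-closed (mA n)))
      (λ _ ¬as (n , a) → ¬as n a) (λ _ ¬∃ n a → ¬∃ (n , a))
  ∁-closed (chainInter A dec mA) =
    reshape (chainUnion (λ n → ∁ (A n)) (λ n p ¬a a → ¬a (dec n p a)) (λ n → ∁-closed (mA n)))
      (λ _ (n , ¬a) all → ¬a (all n))
      (λ _ ¬all → dne (λ ¬∃ → ¬all (λ n → dne (λ ¬a → ¬∃ (n , ¬a)))))
  ∁-closed (ext m P⇔Q) =
    reshape (∁-closed m) (λ p ¬a b → ¬a (from (P⇔Q p) b)) (λ p ¬b a → ¬b (to (P⇔Q p) a))

  -- The partial unions A 0 ∪ ⋯ ∪ A n, an increasing chain with union ⋃ A.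
  ⋃≤ : ∀ {c} → (ℕ → Subset c) → ℕ → Subset c
  ⋃≤ A zero = A zero
  ⋃≤ A (suc n) = ⋃≤ A n ∪ A (suc n)

  ⋃≤-elim : ∀ {c} (A : ℕ → Subset c) n {p} → ⋃≤ A n p → ∃ λ k → k ≤ n × A k p
  ⋃≤-elim A zero a = zero , z≤n , a
  ⋃≤-elim A (suc n) (inj₁ as) = let (k , k≤n , a) = ⋃≤-elim A n as in k , m≤n⇒m≤1+n k≤n , a
  ⋃≤-elim A (suc n) (inj₂ a) = suc n , ≤-refl , a

  ⋃≤-intro : ∀ {c} (A : ℕ → Subset c) n {p} → A n p → ⋃≤ A n p
  ⋃≤-intro A zero a = a
  ⋃≤-intro A (suc n) a = inj₂ a

  ⋃≤∈M : ∀ {c} (A : ℕ → Subset c) → (∀ m n → m ≢ n → Disjoint (A m) (A n)) →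
         (∀ n → M c (A n)) → ∀ n → M c (⋃≤ A n)
  ⋃≤∈M A A# mA zero = mA zero
  ⋃≤∈M A A# mA (suc n) = disjUnion apart (⋃≤∈M A A# mA n) (mA (suc n))
    where
      apart : Disjoint (⋃≤ A n) (A (suc n))
      apart p as a = let (k , k≤n , a′) = ⋃≤-elim A n as in
        A# k (suc n) (λ k≡1+n → 1+n≰n (subst (_≤ n) k≡1+n k≤n)) p a′ a

  ⋃-disjoint : ∀ {c} (A : ℕ → Subset c) → (∀ m n → m ≢ n → Disjoint (A m) (A n)) →
               (∀ n → M c (A n)) → M c (⋃ A)
  ⋃-disjoint A A# mA = reshape (chainUnion (⋃≤ A) (λ _ _ → inj₁) (⋃≤∈M A A# mA))
    (λ _ (n , as) → let (k , _ , a) = ⋃≤-elim A n as in k , a)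
    (λ _ (n , a) → n , ⋃≤-intro A n a)

proposition4p8 : (R : PCSemiring) → StandingAssumptions R →
                 (Λ : Set) (ar : Λ → ℕ) (C : Set) (γ : C → T R (F Λ ar C)) →
                 ExcludedMiddle 0ℓ →
                 (c : C) →
                 Paths.IsDynkin R Λ ar C γ c (Paths.M R Λ ar C γ c) ×
                 Paths.ClosedUnderIntersection R Λ ar C γ c (Paths.M R Λ ar C γ c)
proposition4p8 R _ Λ ar C γ em c =
  (Paths.full , (λ _ → ∁-closed) , ⋃-disjoint) , (λ _ _ → ∩-closed)
  where open Proof R Λ ar C γ em
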